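{- Let $B_1$ and $B_2$ be bouquets (ribbon graphs with exactly one vertex) that have the same intersection graph, i.e. $I(B_1)=I(B_2)$ (after identifying their edge sets). Then \[{^\partial\varepsilon^{\times}_{B_1}(z)}={^\partial\varepsilon^{\times}_{B_2}(z)}.\]
   Context: A ribbon graph $G$ is a (possibly non-orientable) surface with boundary formed from vertex discs and edge discs (ribbons), each edge attached to vertex discs along two disjoint arcs. Let $v(G),e(G),f(G),c(G)$ be the numbers of vertices, edges, boundary components and connected components. The Euler genus is $\varepsilon(G)=2c(G)-v(G)+e(G)-f(G)$. For $A\subseteq E(G)$, the partial Petrial $G^{\times|A}$ is obtained from $G$ by adding a half-twist to each edge in $A$. The partial Petrial polynomial is ${^\partial\varepsilon^{\times}_{G}(z)}=\sum_{A\subseteq E(G)} z^{\varepsilon(G^{\times|A})}$. A bouquet is a ribbon graph with exactly one vertex. Two loops of a bouquet are interlaced if their ends alternate when travelling round the vertex boundary. The intersection graph $I(B)$ of a bouquet $B$ has vertex set $E(B)$, two vertices being adjacent iff the corresponding loops are interlaced. -}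

module Defs where

open import Data.Nat using (ℕ; zero; suc; _+_; _*_; _<?_; _≤ᵇ_)
open import Data.Integer using (ℤ; +_; _-_)
open import Data.Bool using (Bool; true; false; not; _xor_; _∧_; _∨_; if_then_else_)
open import Data.Fin using (Fin; zero; suc; toℕ; fromℕ; fromℕ<; inject₁)
open import Data.Product using (_×_; _,_; proj₁; proj₂)
open import Data.List using (List; []; _∷_; _++_; map; allFin; cartesianProduct; foldr)
open import Data.Vec using (Vec; lookup)
import Data.Vec as Vec
open import Relation.Nullary.Decidable using (yes; no; ⌊_⌋)
open import Relation.Binary.PropositionalEquality using (_≡_)
import Data.Integer as ℤ

-- A bouquet with edge set Fin n has 2n edge-ends placed at positions
-- Fin (n + n) in cyclic order around the boundary of its single vertex
-- disc.  'pos (e , b)' is the position of end b of loop e, 'lab' is the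
-- inverse labelling.  'twisted e' records whether the ribbon of e is
-- attached with a half-twist (orientation reversing) or not.

record Bouquet (n : ℕ) : Set where
  field
    pos     : Fin n × Bool → Fin (n + n)
    lab     : Fin (n + n) → Fin n × Bool
    lab∘pos : ∀ x → lab (pos x) ≡ x
    pos∘lab : ∀ i → pos (lab i) ≡ i
    twisted : Fin n → Bool
open Bouquet public

sucMod : ∀ {m} → Fin m → Fin m
sucMod {suc k} i with suc (toℕ i) <? suc k
... | yes p = fromℕ< p
... | no _  = zero

predMod : ∀ {m} → Fin m → Fin m
predMod {suc k} zero    = fromℕ k
predMod {suc k} (suc i) = inject₁ i

-- A "side point" (i , s) is the left
-- (s = false) or right (s = true) side of the edge-end at position i,
-- i.e. a point of the vertex boundary where an edge ribbon is attached.
-- The boundary of the surface is the union of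
--  * vertex-boundary arcs: right side of i  --  left side of i+1, and
--  * edge-ribbon sides: the ribbon of e joins its two ends; an untwisted
--    ribbon joins right to left and left to right, a twisted one joins
--    right to right and left to left.
-- Boundary components = connected components of the graph on side
-- points formed by these two perfect matchings.

Point : ℕ → Set
Point n = Fin (n + n) × Bool

cornerMatch : ∀ {n} → Point n → Point n
cornerMatch (i , true)  = (sucMod i , false)
cornerMatch (i , false) = (predMod i , true)

edgeMatch : ∀ {n} → Bouquet n → Point n → Point n
edgeMatch B (i , s) =
  let e = proj₁ (lab B i)
      b = proj₂ (lab B i)
  in pos B (e , not b) , (if twisted B e then s else not s)

allPoints : ∀ n → List (Point n)
allPoints n = cartesianProduct (allFin (n + n)) (false ∷ true ∷ [])

iterate : ∀ {A : Set} → ℕ → (A → A) → A → List A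
iterate zero    g x = []
iterate (suc k) g x = x ∷ iterate k g (g x)

component : ∀ {n} → Bouquet n → Point n → List (Point n)
component {n} B x =
  let orb = iterate (suc (4 * n)) (λ p → edgeMatch B (cornerMatch {n} p)) x
  in orb ++ map (cornerMatch {n}) orb

key : ∀ {n} → Point n → ℕ
key (i , s) = 2 * toℕ i + (if s then 1 else 0)

isRep : ∀ {n} → Bouquet n → Point n → Bool
isRep {n} B x = foldr (λ y r → (key {n} x ≤ᵇ key {n} y) ∧ r) true (component B x)

countTrue : List Bool → ℕ
countTrue bs = foldr (λ b r → (if b then 1 else 0) + r) 0 bs

faces : ∀ {n} → Bouquet n → ℕ
faces {n} B = countTrue (map (isRep B) (allPoints n))

-- Euler genus ε(B) = 2c - v + e - f with c = 1, v = 1, e = n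
eulerGenus : ∀ {n} → Bouquet n → ℤ
eulerGenus {n} B = ((+ 2) ℤ.* (+ 1) ℤ.- (+ 1)) ℤ.+ (+ n) ℤ.- (+ faces B)

Subset : ℕ → Set
Subset n = Vec Bool n

partialPetrial : ∀ {n} → Bouquet n → Subset n → Bouquet n
partialPetrial B A = record
  { pos = pos B ; lab = lab B ; lab∘pos = lab∘pos B ; pos∘lab = pos∘lab B
  ; twisted = λ e → twisted B e xor lookup A e }

allSubsets : ∀ n → List (Subset n)
allSubsets zero    = Vec.[] ∷ []
allSubsets (suc n) = map (false Vec.∷_) (allSubsets n) ++ map (true Vec.∷_) (allSubsets n)

-- coefficient of z^k in the partial Petrial polynomial
-- ∂ε×_B(z) = Σ_{A ⊆ E(B)} z^{ε(B^{×|A})}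
petrialCoeff : ∀ {n} → Bouquet n → ℤ → ℕ
petrialCoeff {n} B k =
  countTrue (map (λ A → ⌊ eulerGenus (partialPetrial B A) ℤ.≟ k ⌋) (allSubsets n))

SamePetrialPoly : ∀ {n m} → Bouquet n → Bouquet m → Set
SamePetrialPoly B₁ B₂ = ∀ (k : ℤ) → petrialCoeff B₁ k ≡ petrialCoeff B₂ k

strictlyBetween : ℕ → ℕ → ℕ → Bool
strictlyBetween x y z =
  ((suc x ≤ᵇ z) ∧ (suc z ≤ᵇ y)) ∨ ((suc y ≤ᵇ z) ∧ (suc z ≤ᵇ x))

-- loops e and f are interlaced iff exactly one end of f lies on the
-- arc between the two ends of e (i.e. the ends alternate around the vertex)
interlaced : ∀ {n} → Bouquet n → Fin n → Fin n → Bool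
interlaced B e f =
  let a = toℕ (pos B (e , false))
      b = toℕ (pos B (e , true))
      c = toℕ (pos B (f , false))
      d = toℕ (pos B (f , true))
  in strictlyBetween a b c xor strictlyBetween a b d

module Submission where

-- Colour the side points of the vertex boundary (the points where ribbons are attached) so that the
-- colour is constant along every boundary component; there are 2^f(B) such colourings. Walking round the
-- vertex, such a colouring changes exactly across the ends of the loops of some set S, and it is
-- determined by S and its first colour. It is constant along the sides of the ribbon of a loop e iff
-- t_e S_e + Σ_f I_ef S_f = 0 over 𝔽₂ (t_e = 1 iff e is twisted, I = I(B)): between the two ends of e the
-- colour flips once per end strictly between them, and once more if e is twisted. Hence
-- 2^f(B) = 2 |ker(diag t + I)|, so f(B) depends only on t and I(B) up to relabelling. A partial Petrial adds
-- A to t, and A ↦ φ(A + t₁) + t₂ pairs the partial Petrials of B₁ and B₂ with equal Euler genus.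

open import Algebra.Bundles using (CommutativeRing)
open import Data.Bool using (Bool; true; false; not; _xor_; _∧_; if_then_else_; T)
open import Data.Bool.Properties renaming (_≟_ to _≟ᵇ_)
  using (T?; T-∧; T-≡; not-involutive; not-¬; ∧-comm; ∧-zeroʳ; ∨-comm; ∨-identityʳ; ∧-distribʳ-xor;
         xor-assoc; xor-comm; xor-same; xor-identityʳ; xor-inverseˡ; xor-∧-commutativeRing)
open import Algebra.Properties.Semiring.Sum (CommutativeRing.semiring xor-∧-commutativeRing)
  using (sum-syntax; ∑-distrib-+; ∑-permute; sum-cong-≗)
open import Data.Empty using (⊥)
open import Data.Fin using (Fin; zero; suc; toℕ; fromℕ; inject₁; combine; _↑ˡ_; _↑ʳ_; splitAt; join)
open import Data.Fin.Permutation using (Permutation′; permutation; flip; _⟨$⟩ʳ_; _⟨$⟩ˡ_; inverseˡ; inverseʳ)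
open import Data.Fin.Properties
  using (all?; pigeonhole; toℕ<n; toℕ-fromℕ; toℕ-fromℕ<; toℕ-inject₁; toℕ-injective; toℕ-combine;
         combine-injective; splitAt-↑ˡ; splitAt-↑ʳ; join-splitAt)
import Data.Integer as ℤ
import Data.List as List
open import Data.List using (List; []; _∷_; _++_; map; filter; length; foldr; allFin; cartesianProduct)
open import Data.List.Membership.Propositional using (_∈_)
open import Data.List.Membership.Propositional.Properties
  using (∈-map⁺; ∈-map⁻; ∈-filter⁺; ∈-filter⁻; ∈-++⁺ˡ; ∈-++⁺ʳ; ∈-++⁻; ∈-allFin; ∈-cartesianProduct⁺)
open import Data.List.Membership.Propositional.Properties.WithK using (unique∧set⇒bag)
open import Data.List.Properties
  using (length-map; length-++; map-∘; map-cong; map-id-local; map-tabulate; filter-++; filter-none;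
         filter-accept; filter-reject)
open import Data.List.Relation.Binary.BagAndSetEquality using (∼bag⇒↭)
open import Data.List.Relation.Binary.Permutation.Propositional.Properties using (↭-length)
import Data.List.Relation.Unary.All as All
open import Data.List.Relation.Unary.AllPairs using ([]; _∷_)
open import Data.List.Relation.Unary.Any using (here; there)
open import Data.List.Relation.Unary.Unique.Propositional using (Unique)
import Data.List.Relation.Unary.Unique.Propositional.Properties as Unique
open import Data.Maybe using (Maybe; just; nothing)
open import Data.Nat using (ℕ; zero; suc; _+_; _*_; _^_; _∸_; _≤_; _<_; z≤n; s≤s; _<ᵇ_; _≡ᵇ_)
import Data.Nat.GeneralisedArithmetic as GA
open import Data.Nat.Properties
  using (≤-totalOrder; ≤-reflexive; ≤-trans; ≤-antisym; ≤-pred; <⇒≤; <⇒≢; <-irrefl; <-cmp; ≤-<-trans; ≮⇒≥;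
         ≤⇒≯; _≤?_; _<?_; n<1+n; m≤n+m; m∸n≤m; m∸n+n≡m; m+[n∸m]≡n; +-assoc; +-identityʳ; +-suc;
         suc-injective; ^-monoʳ-<; ≤ᵇ⇒≤; ≤⇒≤ᵇ; <ᵇ⇒<; <⇒<ᵇ)
open import Data.List.Extrema ≤-totalOrder using (argmin; argmin-sel; f[argmin]≤f[xs])
open import Data.Product using (_×_; _,_; proj₁; proj₂; ∃-syntax)
open import Data.Sum using (_⊎_; inj₁; inj₂; [_,_]′)
open import Data.Vec using ([]; _∷_; lookup; tabulate; head; tail)
open import Data.Vec.Properties using (∷-injectiveʳ; lookup∘tabulate; tabulate∘lookup; tabulate-cong)
open import Function using (id; _∘_)
open import Function.Bundles using (mk⇔; Equivalence)
open import Level using (0ℓ)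
open import Relation.Binary.Definitions using (tri<; tri≈; tri>)
open import Relation.Binary.PropositionalEquality
open import Relation.Nullary using (¬_; Dec; does; yes; no; contradiction; map′; _→-dec_; _×-dec_)
open import Relation.Nullary.Decidable using (isYes≗does)
open import Relation.Unary using (Pred; Decidable)
open import Tactic.RingSolver using (solve-∀)
open import Tactic.RingSolver.Core.AlmostCommutativeRing using (AlmostCommutativeRing; fromCommutativeRing)

open import Defs

private
  variable
    A B : Set

-- Coefficients of the ring solver live in 𝔽₂ itself, so x xor x normalises to false.
𝔽₂ : AlmostCommutativeRing 0ℓ 0ℓ
𝔽₂ = fromCommutativeRing xor-∧-commutativeRing false≟
  where
  false≟ : (x : Bool) → Maybe (false ≡ x)
  false≟ false = just refl
  false≟ true  = nothing

xor-cancelˡ : ∀ x y → x xor (x xor y) ≡ y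
xor-cancelˡ = solve-∀ 𝔽₂

xor≡false⇒≡ : ∀ {x y} → x xor y ≡ false → x ≡ y
xor≡false⇒≡ {false} {false} _ = refl
xor≡false⇒≡ {true}  {true}  _ = refl

twist-parity : ∀ t s d → (not s ∧ d) xor ((if t then s else not s) ∧ d) ≡ t ∧ d
twist-parity true  s d = trans (sym (∧-distribʳ-xor d (not s) s)) (cong (_∧ d) (xor-inverseˡ s))
twist-parity false s d = xor-same (not s ∧ d)

∑-false : ∀ k → ∑[ i < k ] false ≡ false
∑-false zero    = refl
∑-false (suc k) = ∑-false k

∑-δ : ∀ {k} (f : Fin k → Bool) i → ∑[ j < k ] ((toℕ j ≡ᵇ toℕ i) ∧ f j) ≡ f i
∑-δ {suc k} f zero    = trans (cong (f zero xor_) (∑-false k)) (xor-identityʳ (f zero))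
∑-δ {suc k} f (suc i) = ∑-δ (λ j → f (suc j)) i

count : {P : Pred A 0ℓ} → Decidable P → List A → ℕ
count P? xs = length (filter P? xs)

countTrue-map : {P : Pred A 0ℓ} (P? : Decidable P) (xs : List A) →
                countTrue (map (λ x → does (P? x)) xs) ≡ count P? xs
countTrue-map P? []       = refl
countTrue-map P? (x ∷ xs) with P? x
... | yes _ = cong suc (countTrue-map P? xs)
... | no  _ = countTrue-map P? xs

record Enumeration (A : Set) : Set where
  field
    elements : List A
    complete : ∀ a → a ∈ elements
    unique   : Unique elements
open Enumeration

record Correspondence {A B : Set} (P : Pred A 0ℓ) (Q : Pred B 0ℓ) : Set where
  field
    to             : A → B
    from           : B → A
    to-preserves   : ∀ {a} → P a → Q (to a)
    from-preserves : ∀ {b} → Q b → P (from b)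
    from∘to        : ∀ {a} → P a → from (to a) ≡ a
    to∘from        : ∀ {b} → Q b → to (from b) ≡ b

module _ {P : Pred A 0ℓ} {Q : Pred B 0ℓ} (P? : Decidable P) (Q? : Decidable Q) where

  count-correspondence : (EA : Enumeration A) (EB : Enumeration B) → Correspondence P Q →
                         count P? (elements EA) ≡ count Q? (elements EB)
  count-correspondence EA EB φ = begin
    length Ps           ≡⟨ length-map to Ps ⟨
    length (map to Ps)  ≡⟨ ↭-length (∼bag⇒↭ (unique∧set⇒bag to-Ps-unique Qs-unique (mk⇔ ⊆Qs ⊇Qs))) ⟩
    length Qs           ∎
    where
    open Correspondence φ
    open ≡-Reasoning
    Ps = filter P? (elements EA)
    Qs = filter Q? (elements EB)
    Qs-unique : Unique Qs
    Qs-unique = Unique.filter⁺ Q? (unique EB)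
    P-of : ∀ {a} → a ∈ Ps → P a
    P-of = proj₂ ∘ ∈-filter⁻ P? {xs = elements EA}
    Q-of : ∀ {b} → b ∈ Qs → Q b
    Q-of = proj₂ ∘ ∈-filter⁻ Q? {xs = elements EB}
    -- `to` need not be injective, but it is on Ps, where `from` undoes it.
    to-Ps-unique : Unique (map to Ps)
    to-Ps-unique = Unique.map⁻ {f = from} (subst Unique (sym from∘to-on-Ps) (Unique.filter⁺ P? (unique EA)))
      where
      from∘to-on-Ps : map from (map to Ps) ≡ Ps
      from∘to-on-Ps = trans (sym (map-∘ Ps)) (map-id-local (All.tabulate (from∘to ∘ P-of)))
    ⊆Qs : ∀ {b} → b ∈ map to Ps → b ∈ Qs
    ⊆Qs b∈ with ∈-map⁻ to b∈
    ... | a , a∈ , refl = ∈-filter⁺ Q? (complete EB (to a)) (to-preserves (P-of a∈))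
    ⊇Qs : ∀ {b} → b ∈ Qs → b ∈ map to Ps
    ⊇Qs {b} b∈ = subst (_∈ map to Ps) (to∘from (Q-of b∈))
                       (∈-map⁺ to (∈-filter⁺ P? (complete EA (from b)) (from-preserves (Q-of b∈))))

module _ {P : Pred A 0ℓ} (P? : Decidable P) where

  count-++ : ∀ xs ys → count P? (xs ++ ys) ≡ count P? xs + count P? ys
  count-++ xs ys = trans (cong length (filter-++ P? xs ys)) (length-++ (filter P? xs))

  count-map : (f : B → A) (xs : List B) → count P? (map f xs) ≡ count (λ x → P? (f x)) xs
  count-map f []       = refl
  count-map f (x ∷ xs) with P? (f x)
  ... | yes _ = cong suc (count-map f xs)
  ... | no  _ = count-map f xs

  count-none : (∀ x → ¬ P x) → ∀ xs → count P? xs ≡ 0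
  count-none ¬P xs = cong length (filter-none P? {xs} (All.tabulate (λ {x} _ → ¬P x)))

count-allFin-suc : ∀ {k} {P : Pred (Fin (suc k)) 0ℓ} (P? : Decidable P) →
                   count P? (allFin (suc k)) ≡ count P? (zero ∷ []) + count (λ i → P? (suc i)) (allFin k)
count-allFin-suc {k} P? = trans (count-++ P? (zero ∷ []) (List.tabulate suc))
  (cong (count P? (zero ∷ []) +_) (trans (cong (count P?) (sym (map-tabulate id suc))) (count-map P? suc (allFin k))))

count-cong : {P Q : Pred A 0ℓ} (P? : Decidable P) (Q? : Decidable Q) →
             (∀ x → P x → Q x) → (∀ x → Q x → P x) → ∀ xs → count P? xs ≡ count Q? xs
count-cong P? Q? P⇒Q Q⇒P []       = refl
count-cong P? Q? P⇒Q Q⇒P (x ∷ xs) with P? x | Q? x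
... | yes _  | yes _  = cong suc (count-cong P? Q? P⇒Q Q⇒P xs)
... | no  _  | no  _  = count-cong P? Q? P⇒Q Q⇒P xs
... | yes Px | no ¬Qx = contradiction (P⇒Q x Px) ¬Qx
... | no ¬Px | yes Qx = contradiction (Q⇒P x Qx) ¬Px

allFin-enumeration : ∀ k → Enumeration (Fin k)
allFin-enumeration k = record { elements = allFin k ; complete = ∈-allFin ; unique = Unique.allFin⁺ k }

pairs-enumeration : ∀ k → Enumeration (Fin k × Bool)
pairs-enumeration k = record
  { elements = cartesianProduct (allFin k) (false ∷ true ∷ [])
  ; complete = λ (i , b) → ∈-cartesianProduct⁺ (∈-allFin i) (∈-bools b)
  ; unique   = Unique.cartesianProduct⁺ (Unique.allFin⁺ k) (((λ ()) All.∷ All.[]) ∷ All.[] ∷ [])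
  }
  where
  ∈-bools : ∀ b → b ∈ false ∷ true ∷ []
  ∈-bools false = here refl
  ∈-bools true  = there (here refl)

subsets-enumeration : ∀ k → Enumeration (Subset k)
subsets-enumeration k = record { elements = allSubsets k ; complete = ∈-allSubsets ; unique = allSubsets-unique k }
  where
  ∈-allSubsets : ∀ {k} (V : Subset k) → V ∈ allSubsets k
  ∈-allSubsets []          = here refl
  ∈-allSubsets (false ∷ V) = ∈-++⁺ˡ (∈-map⁺ (false ∷_) (∈-allSubsets V))
  ∈-allSubsets (true  ∷ V) = ∈-++⁺ʳ _ (∈-map⁺ (true ∷_) (∈-allSubsets V))
  allSubsets-unique : ∀ k → Unique (allSubsets k)
  allSubsets-unique zero    = All.[] ∷ []
  allSubsets-unique (suc k) = Unique.++⁺ (Unique.map⁺ ∷-injectiveʳ (allSubsets-unique k))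
    (Unique.map⁺ ∷-injectiveʳ (allSubsets-unique k)) heads-differ
    where
    heads-differ : ∀ {V} → V ∈ map (false ∷_) (allSubsets k) × V ∈ map (true ∷_) (allSubsets k) → ⊥
    heads-differ (V∈₀ , V∈₁) with ∈-map⁻ (false ∷_) V∈₀ | ∈-map⁻ (true ∷_) V∈₁
    ... | _ , _ , refl | _ , _ , ()

Within : ∀ {k} → Pred (Fin k) 0ℓ → Pred (Subset k) 0ℓ
Within R V = ∀ i → T (lookup V i) → R i

within? : ∀ {k} {R : Pred (Fin k) 0ℓ} → Decidable R → Decidable (Within R)
within? R? V = all? (λ i → T? (lookup V i) →-dec R? i)

count-within : ∀ {k} {R : Pred (Fin k) 0ℓ} (R? : Decidable R) →
               count (within? R?) (allSubsets k) ≡ 2 ^ count R? (allFin k)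
count-within {zero}      R? = refl
count-within {suc k} {R} R? = begin
  count (within? R?) (map (false ∷_) ss ++ map (true ∷_) ss)
    ≡⟨ count-++ (within? R?) (map (false ∷_) ss) _ ⟩
  count (within? R?) (map (false ∷_) ss) + count (within? R?) (map (true ∷_) ss)
    ≡⟨ cong₂ _+_ (count-map (within? R?) (false ∷_) ss) (count-map (within? R?) (true ∷_) ss) ⟩
  count (λ V → within? R? (false ∷ V)) ss + count (λ V → within? R? (true ∷ V)) ss
    ≡⟨ cong (_+ count (λ V → within? R? (true ∷ V)) ss) (count-within-tail (λ ())) ⟩
  2 ^ c + count (λ V → within? R? (true ∷ V)) ss
    ≡⟨ head-case (R? zero) ⟩
  2 ^ (count R? (zero ∷ []) + c)
    ≡⟨ cong (2 ^_) (count-allFin-suc R?) ⟨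
  2 ^ count R? (allFin (suc k)) ∎
  where
  open ≡-Reasoning
  ss = allSubsets k
  c = count (λ i → R? (suc i)) (allFin k)
  count-within-tail : ∀ {b} → (T b → R zero) → count (λ V → within? R? (b ∷ V)) ss ≡ 2 ^ c
  count-within-tail {b} head-ok = trans
    (count-cong _ (within? (λ i → R? (suc i)))
                (λ _ W i → W (suc i)) (λ _ W → λ { zero → head-ok ; (suc i) → W i }) ss)
    (count-within (λ i → R? (suc i)))
  head-case : Dec (R zero) → 2 ^ c + count (λ V → within? R? (true ∷ V)) ss ≡ 2 ^ (count R? (zero ∷ []) + c)
  head-case (yes R0) rewrite filter-accept R? {xs = []} R0 =
    cong (2 ^ c +_) (trans (count-within-tail (λ _ → R0)) (sym (+-identityʳ (2 ^ c))))
  head-case (no ¬R0) rewrite filter-reject R? {xs = []} ¬R0 =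
    trans (cong (2 ^ c +_) (count-none _ (λ V W → ¬R0 (W zero _)) ss)) (+-identityʳ (2 ^ c))

count-tail : ∀ {k} {P : Pred (Subset k) 0ℓ} (P? : Decidable P) →
             count (λ V → P? (tail V)) (allSubsets (suc k)) ≡ 2 * count P? (allSubsets k)
count-tail {k} P? = begin
  count (λ V → P? (tail V)) (map (false ∷_) ss ++ map (true ∷_) ss)
    ≡⟨ count-++ (λ V → P? (tail V)) (map (false ∷_) ss) _ ⟩
  count (λ V → P? (tail V)) (map (false ∷_) ss) + count (λ V → P? (tail V)) (map (true ∷_) ss)
    ≡⟨ cong₂ _+_ (count-map (λ V → P? (tail V)) (false ∷_) ss) (count-map (λ V → P? (tail V)) (true ∷_) ss) ⟩
  count P? ss + count P? ss
    ≡⟨ cong (count P? ss +_) (+-identityʳ (count P? ss)) ⟨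
  2 * count P? ss ∎
  where
  open ≡-Reasoning
  ss = allSubsets k

module _ (p : A → Bool) where

  foldr-∧⇒All : ∀ xs → T (foldr (λ y r → p y ∧ r) true xs) → All.All (T ∘ p) xs
  foldr-∧⇒All []       _   = All.[]
  foldr-∧⇒All (x ∷ xs) all = let px , pxs = Equivalence.to T-∧ all in px All.∷ foldr-∧⇒All xs pxs

  All⇒foldr-∧ : ∀ xs → All.All (T ∘ p) xs → T (foldr (λ y r → p y ∧ r) true xs)
  All⇒foldr-∧ []       All.[]         = _
  All⇒foldr-∧ (x ∷ xs) (px All.∷ pxs) = Equivalence.from T-∧ (px , All⇒foldr-∧ xs pxs)

module _ {k : ℕ} where

  toFin : Fin k × Bool → Fin (k + k)
  toFin (i , false) = i ↑ˡ k
  toFin (i , true)  = k ↑ʳ i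

  fromFin : Fin (k + k) → Fin k × Bool
  fromFin j = [ (_, false) , (_, true) ]′ (splitAt k j)

  fromFin-toFin : ∀ x → fromFin (toFin x) ≡ x
  fromFin-toFin (i , false) = cong [ (_, false) , (_, true) ]′ (splitAt-↑ˡ k i k)
  fromFin-toFin (i , true)  = cong [ (_, false) , (_, true) ]′ (splitAt-↑ʳ k k i)

  toFin-fromFin : ∀ j → toFin (fromFin j) ≡ j
  toFin-fromFin j with splitAt k j in eq
  ... | inj₁ i = trans (cong (join k k) (sym eq)) (join-splitAt k k j)
  ... | inj₂ i = trans (cong (join k k) (sym eq)) (join-splitAt k k j)

  toFin-injective : ∀ {x y} → toFin x ≡ toFin y → x ≡ y
  toFin-injective {x} {y} eq = trans (sym (fromFin-toFin x)) (trans (cong fromFin eq) (fromFin-toFin y))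

  ∀-pairs? : {P : Pred (Fin k × Bool) 0ℓ} → Decidable P → Dec (∀ x → P x)
  ∀-pairs? {P} P? = map′ (λ ∀P x → subst P (fromFin-toFin x) (∀P (toFin x))) (λ ∀P j → ∀P (fromFin j))
                         (all? (λ j → P? (fromFin j)))

∑-++ : ∀ m {n} (f : Fin (m + n) → Bool) →
       ∑[ j < m + n ] f j ≡ ∑[ i < m ] f (i ↑ˡ n) xor ∑[ i < n ] f (m ↑ʳ i)
∑-++ zero    f = refl
∑-++ (suc m) f = trans (cong (f zero xor_) (∑-++ m (λ j → f (suc j))))
  (sym (xor-assoc (f zero) _ _))

∑-pairs : ∀ {k} (f : Fin (k + k) → Bool) →
          ∑[ j < k + k ] f j ≡ ∑[ i < k ] (f (toFin (i , false)) xor f (toFin (i , true)))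
∑-pairs {k} f = trans (∑-++ k f) (sym (∑-distrib-+ (λ i → f (i ↑ˡ k)) (λ i → f (k ↑ʳ i))))

module Orbit {A : Set} (g : A → A) (g-injective : ∀ {x y} → g x ≡ g y → x ≡ y) where

  g^ : ℕ → A → A
  g^ j x = GA.iterate g x j

  g^-suc : ∀ j x → g^ (suc j) x ≡ g (g^ j x)
  g^-suc zero    x = refl
  g^-suc (suc j) x = g^-suc j (g x)

  g^-+ : ∀ i j x → g^ (i + j) x ≡ g^ i (g^ j x)
  g^-+ i zero    x = cong (λ l → g^ l x) (+-identityʳ i)
  g^-+ i (suc j) x = trans (cong (λ l → g^ l x) (+-suc i j)) (g^-+ i j (g x))

  g^-injective : ∀ j {x y} → g^ j x ≡ g^ j y → x ≡ y
  g^-injective zero    eq = eq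
  g^-injective (suc j) eq = g-injective (g^-injective j eq)

  ∈-iterate⁺ : ∀ {k j} x → j < k → g^ j x ∈ iterate k g x
  ∈-iterate⁺ {suc k} {zero}  x _         = here refl
  ∈-iterate⁺ {suc k} {suc j} x (s≤s j<k) = there (∈-iterate⁺ (g x) j<k)

  ∈-iterate⁻ : ∀ {k y} x → y ∈ iterate k g x → ∃[ j ] j < k × y ≡ g^ j x
  ∈-iterate⁻ {suc k} x (here refl) = 0 , s≤s z≤n , refl
  ∈-iterate⁻ {suc k} x (there y∈) with ∈-iterate⁻ (g x) y∈
  ... | j , j<k , refl = suc j , s≤s j<k , refl

  module Bounded {K} (encode : A → Fin K) (encode-injective : ∀ {x y} → encode x ≡ encode y → x ≡ y)
                 {k} (K≤k : K ≤ k) where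

    period : ∀ x → ∃[ p ] suc p ≤ K × g^ (suc p) x ≡ x
    period x with pigeonhole (n<1+n K) (λ (i : Fin (suc K)) → encode (g^ (toℕ i) x))
    ... | i , j , i<j , eq = p , bound , g^-injective (toℕ i) (begin
        g^ (toℕ i) (g^ (suc p) x) ≡⟨ g^-+ (toℕ i) (suc p) x ⟨
        g^ (toℕ i + suc p) x      ≡⟨ cong (λ l → g^ l x) i+p≡j ⟩
        g^ (toℕ j) x              ≡⟨ encode-injective eq ⟨
        g^ (toℕ i) x              ∎)
      where
      open ≡-Reasoning
      p = toℕ j ∸ suc (toℕ i)
      i+p≡j : toℕ i + suc p ≡ toℕ j
      i+p≡j = trans (+-suc (toℕ i) p) (m+[n∸m]≡n i<j)
      bound : suc p ≤ K
      bound = ≤-trans (m≤n+m (suc p) (toℕ i)) (≤-trans (≤-reflexive i+p≡j) (≤-pred (toℕ<n j)))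

    g^-reduce : ∀ x j → ∃[ r ] r ≤ k × g^ j x ≡ g^ r x
    g^-reduce x zero    = 0 , z≤n , refl
    g^-reduce x (suc j) = reduce-suc (g^-reduce x j) (period x)
      where
      reduce-suc : ∃[ r ] r ≤ k × g^ j x ≡ g^ r x → ∃[ p ] suc p ≤ K × g^ (suc p) x ≡ x →
             ∃[ r ] r ≤ k × g^ (suc j) x ≡ g^ r x
      reduce-suc (r , r≤k , eq) (p , p<K , gᵖ⁺¹x≡x) with suc r ≤? k
      ... | yes r<k = suc r , r<k , trans (g^-suc j x) (trans (cong g eq) (sym (g^-suc r x)))
      ... | no  r≮k = r ∸ p , ≤-trans (m∸n≤m r p) r≤k , (begin
        g^ (suc j) x               ≡⟨ trans (g^-suc j x) (trans (cong g eq) (sym (g^-suc r x))) ⟩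
        g^ (suc r) x               ≡⟨ cong (λ l → g^ l x) (m∸n+n≡m p≤r) ⟨
        g^ (r ∸ p + suc p) x       ≡⟨ g^-+ (r ∸ p) (suc p) x ⟩
        g^ (r ∸ p) (g^ (suc p) x)  ≡⟨ cong (g^ (r ∸ p)) gᵖ⁺¹x≡x ⟩
        g^ (r ∸ p) x               ∎)
        where
        open ≡-Reasoning
        p≤r : suc p ≤ suc r
        p≤r = s≤s (<⇒≤ (≤-trans p<K (≤-trans K≤k (≮⇒≥ r≮k))))

    g^-∈-iterate : ∀ j x → g^ j x ∈ iterate (suc k) g x
    g^-∈-iterate j x with g^-reduce x j
    ... | r , r≤k , eq = subst (_∈ iterate (suc k) g x) (sym eq) (∈-iterate⁺ x (s≤s r≤k))

    iterate-closed : ∀ x {y} → y ∈ iterate (suc k) g x → g y ∈ iterate (suc k) g x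
    iterate-closed x y∈ with ∈-iterate⁻ x y∈
    ... | j , _ , refl = subst (_∈ iterate (suc k) g x) (g^-suc j x) (g^-∈-iterate (suc j) x)

    iterate-preimage : ∀ x {y} → y ∈ iterate (suc k) g x → ∃[ w ] w ∈ iterate (suc k) g x × g w ≡ y
    iterate-preimage x y∈ with ∈-iterate⁻ x y∈
    ... | suc j , _ , refl = g^ j x , g^-∈-iterate j x , sym (g^-suc j x)
    ... | zero  , _ , refl with period x
    ...   | p , _ , gᵖ⁺¹x≡x = g^ p x , g^-∈-iterate p x , trans (sym (g^-suc p x)) gᵖ⁺¹x≡x

<ᵇ-suc : ∀ j i → (j <ᵇ suc i) ≡ (j <ᵇ i) xor (j ≡ᵇ i)
<ᵇ-suc zero    zero    = refl
<ᵇ-suc zero    (suc i) = refl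
<ᵇ-suc (suc j) zero    = refl
<ᵇ-suc (suc j) (suc i) = <ᵇ-suc j i

<ᵇ-suc-flip : ∀ j i → (j <ᵇ suc i) ≡ not (i <ᵇ j)
<ᵇ-suc-flip zero    i       = refl
<ᵇ-suc-flip (suc j) zero    = refl
<ᵇ-suc-flip (suc j) (suc i) = <ᵇ-suc-flip j i

<ᵇ-true : ∀ {m n} → m < n → (m <ᵇ n) ≡ true
<ᵇ-true m<n = Equivalence.to T-≡ (<⇒<ᵇ m<n)

<ᵇ-false : ∀ {m n} → n ≤ m → (m <ᵇ n) ≡ false
<ᵇ-false {m} {n} n≤m with m <ᵇ n in m<n
... | false = refl
... | true  = contradiction (<ᵇ⇒< m n (subst T (sym m<n) _)) (≤⇒≯ n≤m)

<ᵇ≡false⇒≥ : ∀ {m n} → (m <ᵇ n) ≡ false → n ≤ m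
<ᵇ≡false⇒≥ {m} {n} m≮n = ≮⇒≥ (λ m<n → subst T m≮n (<⇒<ᵇ m<n))

between-<ᵇ : ∀ {p q} → p < q → ∀ z → (z <ᵇ q) xor (z <ᵇ suc p) ≡ strictlyBetween p q z
between-<ᵇ {p} {q} p<q z rewrite <ᵇ-suc-flip z p with p <ᵇ z in p<z
... | true  rewrite <ᵇ-false {z} {p} (<⇒≤ (<ᵇ⇒< p z (subst T (sym p<z) _)))
                  | ∧-zeroʳ (q <ᵇ z) = trans (xor-identityʳ (z <ᵇ q)) (sym (∨-identityʳ (z <ᵇ q)))
... | false rewrite <ᵇ-true {z} {q} (≤-<-trans (<ᵇ≡false⇒≥ p<z) p<q)
                  | <ᵇ-false {q} {z} (<⇒≤ (≤-<-trans (<ᵇ≡false⇒≥ p<z) p<q)) = refl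

endsBefore : ∀ {N} → Fin N × Bool → ℕ
endsBefore (i , false) = toℕ i
endsBefore (i , true)  = suc (toℕ i)

module _ {N} (d : Fin N → Bool) where

  parityBefore : ℕ → Bool
  parityBefore l = ∑[ j < N ] ((toℕ j <ᵇ l) ∧ d j)

  parityBefore-zero : parityBefore 0 ≡ false
  parityBefore-zero = ∑-false N

  parityBefore-all : parityBefore N ≡ ∑[ j < N ] d j
  parityBefore-all = sum-cong-≗ (λ j → cong (_∧ d j) (<ᵇ-true (toℕ<n j)))

  parityBefore-suc : ∀ i → parityBefore (suc (toℕ i)) ≡ parityBefore (toℕ i) xor d i
  parityBefore-suc i = begin
    ∑[ j < N ] ((toℕ j <ᵇ suc (toℕ i)) ∧ d j)
      ≡⟨ sum-cong-≗ (λ j → trans (cong (_∧ d j) (<ᵇ-suc (toℕ j) (toℕ i)))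
                                 (∧-distribʳ-xor (d j) (toℕ j <ᵇ toℕ i) (toℕ j ≡ᵇ toℕ i))) ⟩
    ∑[ j < N ] (((toℕ j <ᵇ toℕ i) ∧ d j) xor ((toℕ j ≡ᵇ toℕ i) ∧ d j))
      ≡⟨ ∑-distrib-+ (λ j → (toℕ j <ᵇ toℕ i) ∧ d j) (λ j → (toℕ j ≡ᵇ toℕ i) ∧ d j) ⟩
    parityBefore (toℕ i) xor ∑[ j < N ] ((toℕ j ≡ᵇ toℕ i) ∧ d j)
      ≡⟨ cong (parityBefore (toℕ i) xor_) (∑-δ d i) ⟩
    parityBefore (toℕ i) xor d i ∎
    where open ≡-Reasoning

  parityBefore-endsBefore : ∀ i s → parityBefore (endsBefore (i , s)) ≡ parityBefore (toℕ i) xor (s ∧ d i)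
  parityBefore-endsBefore i false = sym (xor-identityʳ _)
  parityBefore-endsBefore i true  = parityBefore-suc i

  parityBefore-between : ∀ {p q} → p < q →
                         parityBefore q xor parityBefore (suc p) ≡ ∑[ j < N ] (strictlyBetween p q (toℕ j) ∧ d j)
  parityBefore-between {p} {q} p<q = trans
    (sym (∑-distrib-+ (λ j → (toℕ j <ᵇ q) ∧ d j) (λ j → (toℕ j <ᵇ suc p) ∧ d j)))
    (sum-cong-≗ (λ j → trans (sym (∧-distribʳ-xor (d j) (toℕ j <ᵇ q) (toℕ j <ᵇ suc p)))
                             (cong (_∧ d j) (between-<ᵇ p<q (toℕ j)))))

  parityBefore-crossing : ∀ {p q} → toℕ p < toℕ q → ∀ s s′ →
    parityBefore (endsBefore (q , s′)) xor parityBefore (endsBefore (p , s))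
      ≡ ∑[ j < N ] (strictlyBetween (toℕ p) (toℕ q) (toℕ j) ∧ d j) xor ((not s ∧ d p) xor (s′ ∧ d q))
  parityBefore-crossing {p} {q} p<q s s′ = begin
    parityBefore (endsBefore (q , s′)) xor parityBefore (endsBefore (p , s))
      ≡⟨ cong₂ _xor_ (parityBefore-endsBefore q s′) (parityBefore-endsBefore p s) ⟩
    (parityBefore (toℕ q) xor (s′ ∧ d q)) xor (parityBefore (toℕ p) xor (s ∧ d p))
      ≡⟨ rearrange (parityBefore (toℕ q)) (parityBefore (toℕ p)) (d p) (s ∧ d p) (s′ ∧ d q) ⟩
    (parityBefore (toℕ q) xor (parityBefore (toℕ p) xor d p)) xor ((d p xor (s ∧ d p)) xor (s′ ∧ d q))
      ≡⟨ cong₂ (λ a b → (parityBefore (toℕ q) xor a) xor (b xor (s′ ∧ d q)))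
               (sym (parityBefore-suc p)) (sym (not-∧ s (d p))) ⟩
    (parityBefore (toℕ q) xor parityBefore (suc (toℕ p))) xor ((not s ∧ d p) xor (s′ ∧ d q))
      ≡⟨ cong (_xor ((not s ∧ d p) xor (s′ ∧ d q))) (parityBefore-between p<q) ⟩
    ∑[ j < N ] (strictlyBetween (toℕ p) (toℕ q) (toℕ j) ∧ d j) xor ((not s ∧ d p) xor (s′ ∧ d q)) ∎
    where
    open ≡-Reasoning
    rearrange : ∀ a b x y z → (a xor z) xor (b xor y) ≡ (a xor (b xor x)) xor ((x xor y) xor z)
    rearrange = solve-∀ 𝔽₂
    not-∧ : ∀ s x → not s ∧ x ≡ x xor (s ∧ x)
    not-∧ false x = sym (xor-identityʳ x)
    not-∧ true  x = sym (xor-same x)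

toℕ-sucMod : ∀ {m} (i : Fin m) →
             (toℕ (sucMod i) ≡ suc (toℕ i) × suc (toℕ i) < m) ⊎ (toℕ (sucMod i) ≡ 0 × suc (toℕ i) ≡ m)
toℕ-sucMod {suc k} i with suc (toℕ i) <? suc k
... | yes i+1<m = inj₁ (toℕ-fromℕ< i+1<m , i+1<m)
... | no  i+1≮m = inj₂ (refl , ≤-antisym (toℕ<n i) (≮⇒≥ i+1≮m))

predMod-sucMod : ∀ {m} (i : Fin m) → predMod (sucMod i) ≡ i
predMod-sucMod {suc k} i with toℕ-sucMod i
... | inj₁ (i+1 , _) = toℕ-injective (predMod-suc (sucMod i) i+1)
  where
  predMod-suc : ∀ (j : Fin (suc k)) {t} → toℕ j ≡ suc t → toℕ (predMod j) ≡ t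
  predMod-suc (suc j) eq = trans (toℕ-inject₁ j) (suc-injective eq)
... | inj₂ (zero≡ , last) = toℕ-injective (predMod-zero (sucMod i) zero≡)
  where
  predMod-zero : ∀ (j : Fin (suc k)) → toℕ j ≡ 0 → toℕ (predMod j) ≡ toℕ i
  predMod-zero zero _ = trans (toℕ-fromℕ k) (sym (suc-injective last))

sucMod-predMod : ∀ {m} (i : Fin m) → sucMod (predMod i) ≡ i
sucMod-predMod {suc k} zero with toℕ-sucMod (fromℕ k)
... | inj₁ (_ , k+1<m) = contradiction (subst (λ t → suc t < suc k) (toℕ-fromℕ k) k+1<m) (<-irrefl refl)
... | inj₂ (zero≡ , _) = toℕ-injective zero≡
sucMod-predMod {suc k} (suc j) with toℕ-sucMod (inject₁ j)
... | inj₁ (j+1 , _) = toℕ-injective (trans j+1 (cong suc (toℕ-inject₁ j)))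
... | inj₂ (_ , last) = contradiction (trans (sym (toℕ-inject₁ j)) (suc-injective last)) (<⇒≢ (toℕ<n j))

cornerMatch-involutive : ∀ {n} (x : Point n) → cornerMatch {n} (cornerMatch {n} x) ≡ x
cornerMatch-involutive (i , true)  = cong (_, true) (predMod-sucMod i)
cornerMatch-involutive (i , false) = cong (_, false) (sucMod-predMod i)

key-injective : ∀ {n} {x y : Point n} → key {n} x ≡ key {n} y → x ≡ y
key-injective {n} {i , s} {j , t} eq =
  let i≡j , bs≡bt = combine-injective i (bit s) j (bit t) (toℕ-injective (begin
        toℕ (combine i (bit s)) ≡⟨ toℕ-combine i (bit s) ⟩
        2 * toℕ i + toℕ (bit s) ≡⟨ cong (2 * toℕ i +_) (toℕ-bit s) ⟩
        key {n} (i , s)         ≡⟨ eq ⟩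
        key {n} (j , t)         ≡⟨ cong (2 * toℕ j +_) (toℕ-bit t) ⟨
        2 * toℕ j + toℕ (bit t) ≡⟨ toℕ-combine j (bit t) ⟨
        toℕ (combine j (bit t)) ∎))
  in cong₂ _,_ i≡j (bit-injective bs≡bt)
  where
  open ≡-Reasoning
  bit : Bool → Fin 2
  bit false = zero
  bit true  = suc zero
  toℕ-bit : ∀ s → toℕ (bit s) ≡ (if s then 1 else 0)
  toℕ-bit false = refl
  toℕ-bit true  = refl
  bit-injective : ∀ {s t} → bit s ≡ bit t → s ≡ t
  bit-injective {false} {false} _ = refl
  bit-injective {true}  {true}  _ = refl

[n+n]+[n+n]≡4*n : ∀ n → (n + n) + (n + n) ≡ 4 * n
[n+n]+[n+n]≡4*n n = trans (+-assoc n n (n + n)) (cong (λ t → n + (n + (n + t))) (sym (+-identityʳ n)))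

module Boundary {n : ℕ} (B : Bouquet n) where

  c : Point n → Point n
  c = cornerMatch {n}

  m : Point n → Point n
  m = edgeMatch B

  edgeMatch-involutive : ∀ x → m (m x) ≡ x
  edgeMatch-involutive (i , s) rewrite lab∘pos B (proj₁ (lab B i) , not (proj₂ (lab B i))) =
    cong₂ _,_ (trans (cong (λ b → pos B (proj₁ (lab B i) , b)) (not-involutive _)) (pos∘lab B i))
              (twist-involutive (twisted B (proj₁ (lab B i))) s)
    where
    twist-involutive : ∀ t s → (if t then (if t then s else not s) else not (if t then s else not s)) ≡ s
    twist-involutive true  s = refl
    twist-involutive false s = not-involutive s

  data Linked (x : Point n) : Point n → Set where
    start  : Linked x x
    corner : ∀ {y} → Linked x y → Linked x (c y)
    edge   : ∀ {y} → Linked x y → Linked x (m y)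

  Linked-trans : ∀ {x y z} → Linked x y → Linked y z → Linked x z
  Linked-trans xy start       = xy
  Linked-trans xy (corner yz) = corner (Linked-trans xy yz)
  Linked-trans xy (edge yz)   = edge (Linked-trans xy yz)

  Linked-sym : ∀ {x y} → Linked x y → Linked y x
  Linked-sym start = start
  Linked-sym (corner {y} xy) = Linked-trans (subst (Linked (c y)) (cornerMatch-involutive {n} y) (corner start)) (Linked-sym xy)
  Linked-sym (edge {y} xy)   = Linked-trans (subst (Linked (m y)) (edgeMatch-involutive y) (edge start)) (Linked-sym xy)

  Linked-invariant : (H : Point n → Bool) → (∀ x → H (c x) ≡ H x) → (∀ x → H (m x) ≡ H x) →
                     ∀ {x y} → Linked x y → H y ≡ H x
  Linked-invariant H Hc Hm start       = refl
  Linked-invariant H Hc Hm (corner xy) = trans (Hc _) (Linked-invariant H Hc Hm xy)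
  Linked-invariant H Hc Hm (edge xy)   = trans (Hm _) (Linked-invariant H Hc Hm xy)

  step : Point n → Point n
  step x = m (c x)

  step-retraction : ∀ x → c (m (step x)) ≡ x
  step-retraction x = trans (cong c (edgeMatch-involutive (c x))) (cornerMatch-involutive {n} x)

  step-injective : ∀ {x y} → step x ≡ step y → x ≡ y
  step-injective {x} {y} eq = trans (sym (step-retraction x)) (trans (cong (c ∘ m) eq) (step-retraction y))

  open Orbit step step-injective using (∈-iterate⁻; g^; g^-suc)
  open Orbit.Bounded step step-injective toFin toFin-injective (≤-reflexive ([n+n]+[n+n]≡4*n n))
    using (iterate-closed; iterate-preimage)

  orbit : Point n → List (Point n)
  orbit = iterate (suc (4 * n)) step

  Linked-orbit : ∀ {x y} → y ∈ orbit x → Linked x y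
  Linked-orbit {x} y∈ with ∈-iterate⁻ x y∈
  ... | j , _ , refl = Linked-g^ j
    where
    Linked-g^ : ∀ j → Linked x (g^ j x)
    Linked-g^ zero    = start
    Linked-g^ (suc j) = subst (Linked x) (sym (g^-suc j x)) (edge (corner (Linked-g^ j)))

  ∈-component⁻ : ∀ {x z} → z ∈ component B x → Linked x z
  ∈-component⁻ {x} z∈ with ∈-++⁻ (orbit x) z∈
  ... | inj₁ z∈orbit = Linked-orbit z∈orbit
  ... | inj₂ z∈c-orbit with ∈-map⁻ c z∈c-orbit
  ...   | y , y∈orbit , refl = corner (Linked-orbit y∈orbit)

  component-closed-c : ∀ {x z} → z ∈ component B x → c z ∈ component B x
  component-closed-c {x} z∈ with ∈-++⁻ (orbit x) z∈
  ... | inj₁ z∈orbit = ∈-++⁺ʳ (orbit x) (∈-map⁺ c z∈orbit)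
  ... | inj₂ z∈c-orbit with ∈-map⁻ c z∈c-orbit
  ...   | y , y∈orbit , refl = ∈-++⁺ˡ (subst (_∈ orbit x) (sym (cornerMatch-involutive {n} y)) y∈orbit)

  component-closed-m : ∀ {x z} → z ∈ component B x → m z ∈ component B x
  component-closed-m {x} z∈ with ∈-++⁻ (orbit x) z∈
  ... | inj₁ z∈orbit with iterate-preimage x z∈orbit
  ...   | w , w∈orbit , refl =
    ∈-++⁺ʳ (orbit x) (subst (_∈ map c (orbit x)) (sym (edgeMatch-involutive (c w))) (∈-map⁺ c w∈orbit))
  component-closed-m {x} z∈ | inj₂ z∈c-orbit with ∈-map⁻ c z∈c-orbit
  ...   | y , y∈orbit , refl = ∈-++⁺ˡ (iterate-closed x y∈orbit)

  ∈-component⁺ : ∀ {x z} → Linked x z → z ∈ component B x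
  ∈-component⁺ start       = here refl
  ∈-component⁺ (corner xz) = component-closed-c (∈-component⁺ xz)
  ∈-component⁺ (edge xz)   = component-closed-m (∈-component⁺ xz)

  component-trans : ∀ {x y z} → y ∈ component B x → z ∈ component B y → z ∈ component B x
  component-trans y∈ z∈ = ∈-component⁺ (Linked-trans (∈-component⁻ y∈) (∈-component⁻ z∈))

  component-sym : ∀ {x y z} → y ∈ component B x → z ∈ component B x → z ∈ component B y
  component-sym y∈ z∈ = ∈-component⁺ (Linked-trans (Linked-sym (∈-component⁻ y∈)) (∈-component⁻ z∈))

  Minimal : Point n → Point n → Set
  Minimal x r = ∀ {z} → z ∈ component B x → key {n} r ≤ key {n} z

  isRep⇒Minimal : ∀ {x} → T (isRep B x) → Minimal x x
  isRep⇒Minimal {x} x-rep z∈ = ≤ᵇ⇒≤ _ _ (All.lookup (foldr-∧⇒All _ (component B x) x-rep) z∈)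

  Minimal⇒isRep : ∀ {x} → Minimal x x → T (isRep B x)
  Minimal⇒isRep {x} x-min = All⇒foldr-∧ _ (component B x) (All.tabulate (λ z∈ → ≤⇒≤ᵇ (x-min z∈)))

  rep : Point n → Point n
  rep x = argmin (key {n}) x (component B x)

  rep-∈ : ∀ x → rep x ∈ component B x
  rep-∈ x = [ (λ eq → subst (_∈ component B x) (sym eq) (here refl)) , id ]′ (argmin-sel (key {n}) x (component B x))

  rep-minimal : ∀ x → Minimal x (rep x)
  rep-minimal x z∈ = All.lookup (f[argmin]≤f[xs] {f = key {n}} x (component B x)) z∈

  Minimal-unique : ∀ {x r} → r ∈ component B x → Minimal x r → r ≡ rep x
  Minimal-unique {x} r∈ r-min = key-injective {n} (≤-antisym (r-min (rep-∈ x)) (rep-minimal x r∈))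

  rep-cong : ∀ {x y} → y ∈ component B x → rep y ≡ rep x
  rep-cong {y = y} y∈ =
    Minimal-unique (component-trans y∈ (rep-∈ y)) (λ z∈ → rep-minimal y (component-sym y∈ z∈))

  isRep-rep : ∀ x → T (isRep B (rep x))
  isRep-rep x = Minimal⇒isRep (λ z∈ → rep-minimal x (component-trans (rep-∈ x) z∈))

  rep-isRep : ∀ {x} → T (isRep B x) → rep x ≡ x
  rep-isRep x-rep = sym (Minimal-unique (here refl) (isRep⇒Minimal x-rep))

  Colouring : Set
  Colouring = Subset ((n + n) + (n + n))

  colour : Colouring → Point n → Bool
  colour V x = lookup V (toFin x)

  colouring : (Point n → Bool) → Colouring
  colouring h = tabulate (λ j → h (fromFin j))

  colour-colouring : ∀ h x → colour (colouring h) x ≡ h x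
  colour-colouring h x = trans (lookup∘tabulate (λ j → h (fromFin j)) (toFin x)) (cong h (fromFin-toFin x))

  colouring-colour : ∀ V → colouring (colour V) ≡ V
  colouring-colour V = trans (tabulate-cong (λ j → cong (lookup V) (toFin-fromFin {n + n} j))) (tabulate∘lookup V)

  colouring-cong : ∀ {h h′} → (∀ x → h x ≡ h′ x) → colouring h ≡ colouring h′
  colouring-cong h≗h′ = tabulate-cong (λ j → h≗h′ (fromFin j))

  Invariant : Pred Colouring 0ℓ
  Invariant V = ∀ x → colour V (c x) ≡ colour V x × colour V (m x) ≡ colour V x

  invariant? : Decidable Invariant
  invariant? V = ∀-pairs? (λ x → (colour V (c x) ≟ᵇ colour V x) ×-dec (colour V (m x) ≟ᵇ colour V x))

  isRepAt? : Decidable (λ j → T (isRep B (fromFin j)))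
  isRepAt? j = T? (isRep B (fromFin j))

  OnRepresentatives : Pred Colouring 0ℓ
  OnRepresentatives = Within (λ j → T (isRep B (fromFin j)))

  invariant↔onRepresentatives : Correspondence Invariant OnRepresentatives
  invariant↔onRepresentatives = record
    { to             = restrict
    ; from           = extend
    ; to-preserves   = λ _ j → proj₁ ∘ Equivalence.to T-∧ ∘ subst T (lookup∘tabulate _ j)
    ; from-preserves = λ {W} _ x → extend-c {W} x , extend-m {W} x
    ; from∘to        = from∘to
    ; to∘from        = λ {V} → to∘from {V}
    }
    where
    on-reps extended : Colouring → Point n → Bool
    on-reps V x  = isRep B x ∧ colour V x
    extended W x = colour W (rep x)
    restrict extend : Colouring → Colouring
    restrict V = colouring (on-reps V)
    extend W   = colouring (extended W)
    extend-c : ∀ {W} x → colour (extend W) (c x) ≡ colour (extend W) x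
    extend-c {W} x = trans (colour-colouring (extended W) (c x))
      (trans (cong (colour W) (rep-cong (component-closed-c {x} (here refl)))) (sym (colour-colouring (extended W) x)))
    extend-m : ∀ {W} x → colour (extend W) (m x) ≡ colour (extend W) x
    extend-m {W} x = trans (colour-colouring (extended W) (m x))
      (trans (cong (colour W) (rep-cong (component-closed-m {x} (here refl)))) (sym (colour-colouring (extended W) x)))
    from∘to : ∀ {V} → Invariant V → extend (restrict V) ≡ V
    from∘to {V} inv = trans (colouring-cong (λ x → begin
        colour (restrict V) (rep x)           ≡⟨ colour-colouring (on-reps V) (rep x) ⟩
        isRep B (rep x) ∧ colour V (rep x)    ≡⟨ cong (_∧ colour V (rep x)) (Equivalence.to T-≡ (isRep-rep x)) ⟩
        colour V (rep x)
          ≡⟨ Linked-invariant (colour V) (proj₁ ∘ inv) (proj₂ ∘ inv) (∈-component⁻ (rep-∈ x)) ⟩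
        colour V x                            ∎))
      (colouring-colour V)
      where open ≡-Reasoning
    to∘from : ∀ {W} → OnRepresentatives W → restrict (extend W) ≡ W
    to∘from {W} W-on-reps = trans (colouring-cong on-point) (colouring-colour W)
      where
      on-point : ∀ x → isRep B x ∧ colour (extend W) x ≡ colour W x
      on-point x with isRep B x in x-rep
      ... | true  = trans (colour-colouring (extended W) x) (cong (colour W) (rep-isRep (subst T (sym x-rep) _)))
      ... | false with colour W x in Wx
      ...   | false = refl
      ...   | true  = contradiction
        (subst (T ∘ isRep B) (fromFin-toFin x) (W-on-reps (toFin x) (subst T (sym Wx) _))) (subst T x-rep)

  faces≡count-representatives : faces B ≡ count isRepAt? (allFin ((n + n) + (n + n)))
  faces≡count-representatives = trans (countTrue-map (λ x → T? (isRep B x)) (allPoints n))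
    (count-correspondence _ _ (pairs-enumeration (n + n)) (allFin-enumeration _) (record
      { to             = toFin
      ; from           = fromFin
      ; to-preserves   = λ {x} → subst (T ∘ isRep B) (sym (fromFin-toFin x))
      ; from-preserves = id
      ; from∘to        = λ {x} _ → fromFin-toFin x
      ; to∘from        = λ {j} _ → toFin-fromFin {n + n} j
      }))

  2^faces≡count-invariant : 2 ^ faces B ≡ count invariant? (allSubsets ((n + n) + (n + n)))
  2^faces≡count-invariant = begin
    2 ^ faces B                              ≡⟨ cong (2 ^_) faces≡count-representatives ⟩
    2 ^ count isRepAt? (allFin _)            ≡⟨ count-within isRepAt? ⟨
    count (within? isRepAt?) (allSubsets _)  ≡⟨ count-correspondence invariant? (within? isRepAt?)
                                                  (subsets-enumeration _) (subsets-enumeration _) invariant↔onRepresentatives ⟨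
    count invariant? (allSubsets _)          ∎
    where open ≡-Reasoning

module _ {k} (t : Fin k → Bool) (I : Fin k → Fin k → Bool) where

  matrixImage : Subset k → Fin k → Bool
  matrixImage S e = (t e ∧ lookup S e) xor ∑[ f < k ] (lookup S f ∧ I e f)

  Kernel : Pred (Subset k) 0ℓ
  Kernel S = ∀ e → matrixImage S e ≡ false

  kernel? : Decidable Kernel
  kernel? S = all? (λ e → matrixImage S e ≟ᵇ false)

module LoopSetColouring {n : ℕ} (B : Bouquet n) where

  open Boundary B

  ∑-ends : ∀ (w : Fin (n + n) → Bool) →
           ∑[ j < n + n ] w j ≡ ∑[ e < n ] (w (pos B (e , false)) xor w (pos B (e , true)))
  ∑-ends w = begin
    ∑[ j < n + n ] w j                     ≡⟨ ∑-permute w ends ⟩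
    ∑[ j < n + n ] w (pos B (fromFin j))   ≡⟨ ∑-pairs {n} (λ j → w (pos B (fromFin j))) ⟩
    ∑[ e < n ] (w (pos B (fromFin (toFin (e , false)))) xor w (pos B (fromFin (toFin (e , true)))))
      ≡⟨ sum-cong-≗ (λ e → cong₂ (λ x y → w (pos B x) xor w (pos B y))
                                 (fromFin-toFin (e , false)) (fromFin-toFin (e , true))) ⟩
    ∑[ e < n ] (w (pos B (e , false)) xor w (pos B (e , true))) ∎
    where
    open ≡-Reasoning
    ends : Permutation′ (n + n)
    ends = permutation (λ j → pos B (fromFin j)) (λ i → toFin (lab B i))
      (λ i → trans (cong (pos B) (fromFin-toFin (lab B i))) (pos∘lab B i))
      (λ j → trans (cong toFin (lab∘pos B (fromFin j))) (toFin-fromFin {n} j))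

  endIn : Subset n → Fin (n + n) → Bool
  endIn S j = lookup S (proj₁ (lab B j))

  endIn-pos : ∀ S e b → endIn S (pos B (e , b)) ≡ lookup S e
  endIn-pos S e b = cong (λ end → lookup S (proj₁ end)) (lab∘pos B (e , b))

  ∑-endIn : ∀ S → ∑[ j < n + n ] endIn S j ≡ false
  ∑-endIn S = trans (∑-ends (endIn S)) (trans
    (sum-cong-≗ (λ e → trans (cong₂ _xor_ (endIn-pos S e false) (endIn-pos S e true)) (xor-same (lookup S e))))
    (∑-false n))

  -- Starting with colour b at position 0, the colour flips across every end of a loop of S.
  subsetColouring : Bool → Subset n → Point n → Bool
  subsetColouring b S x = b xor parityBefore (endIn S) (endsBefore x)

  subsetColouring-c : ∀ b S x → subsetColouring b S (c x) ≡ subsetColouring b S x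
  subsetColouring-c b S (i , true) with toℕ-sucMod i
  ... | inj₁ (next , _)       = cong (λ l → b xor parityBefore (endIn S) l) next
  ... | inj₂ (wraps , last) = cong (b xor_) (begin
    parityBefore (endIn S) (toℕ (sucMod i))  ≡⟨ cong (parityBefore (endIn S)) wraps ⟩
    parityBefore (endIn S) 0                 ≡⟨ parityBefore-zero (endIn S) ⟩
    false                                    ≡⟨ ∑-endIn S ⟨
    ∑[ j < n + n ] endIn S j                 ≡⟨ parityBefore-all (endIn S) ⟨
    parityBefore (endIn S) (n + n)           ≡⟨ cong (parityBefore (endIn S)) last ⟨
    parityBefore (endIn S) (suc (toℕ i))     ∎)
    where open ≡-Reasoning
  subsetColouring-c b S (i , false) = sym (trans
    (cong (λ j → subsetColouring b S (j , false)) (sym (sucMod-predMod i)))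
    (subsetColouring-c b S (predMod i , true)))

  loop : Point n → Fin n
  loop x = proj₁ (lab B (proj₁ x))

  loop-m : ∀ x → loop (m x) ≡ loop x
  loop-m (i , s) = cong proj₁ (lab∘pos B (loop (i , s) , not (proj₂ (lab B i))))

  m-moves : ∀ x → proj₁ (m x) ≢ proj₁ x
  m-moves (i , s) eq = not-¬ refl (sym (cong proj₂ (trans (sym (lab∘pos B _)) (cong (lab B) eq))))

  between-interlaced : ∀ S x →
    ∑[ j < n + n ] (strictlyBetween (toℕ (proj₁ x)) (toℕ (proj₁ (m x))) (toℕ j) ∧ endIn S j)
      ≡ ∑[ f < n ] (lookup S f ∧ interlaced B (loop x) f)
  between-interlaced S (i , s) = begin
    ∑[ j < n + n ] (strictlyBetween (toℕ i) (toℕ (pos B (e , not β))) (toℕ j) ∧ endIn S j)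
      ≡⟨ sum-cong-≗ (λ j → cong (_∧ endIn S j) (trans
           (cong (λ r → strictlyBetween (toℕ r) (toℕ (pos B (e , not β))) (toℕ j)) (sym (pos∘lab B i)))
           (between-loop β (toℕ j)))) ⟩
    ∑[ j < n + n ] (between-e (toℕ j) ∧ endIn S j)
      ≡⟨ ∑-ends (λ j → between-e (toℕ j) ∧ endIn S j) ⟩
    ∑[ f < n ] ((between-e (toℕ (pos B (f , false))) ∧ endIn S (pos B (f , false)))
                 xor (between-e (toℕ (pos B (f , true))) ∧ endIn S (pos B (f , true))))
      ≡⟨ sum-cong-≗ both-ends ⟩
    ∑[ f < n ] (lookup S f ∧ interlaced B e f) ∎
    where
    open ≡-Reasoning
    e = proj₁ (lab B i)
    β = proj₂ (lab B i)
    between-e : ℕ → Bool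
    between-e = strictlyBetween (toℕ (pos B (e , false))) (toℕ (pos B (e , true)))
    between-loop : ∀ β z → strictlyBetween (toℕ (pos B (e , β))) (toℕ (pos B (e , not β))) z ≡ between-e z
    between-loop false z = refl
    between-loop true  z = ∨-comm ((toℕ (pos B (e , true)) <ᵇ z) ∧ (z <ᵇ toℕ (pos B (e , false))))
                                  ((toℕ (pos B (e , false)) <ᵇ z) ∧ (z <ᵇ toℕ (pos B (e , true))))
    both-ends : ∀ f → (between-e (toℕ (pos B (f , false))) ∧ endIn S (pos B (f , false)))
                        xor (between-e (toℕ (pos B (f , true))) ∧ endIn S (pos B (f , true)))
                      ≡ lookup S f ∧ interlaced B e f
    both-ends f rewrite endIn-pos S f false | endIn-pos S f true =
      trans (sym (∧-distribʳ-xor (lookup S f) (between-e (toℕ (pos B (f , false))))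
                                               (between-e (toℕ (pos B (f , true))))))
            (∧-comm (interlaced B e f) (lookup S f))

  subsetColouring-m-< : ∀ b S x → toℕ (proj₁ x) < toℕ (proj₁ (m x)) →
                  subsetColouring b S (m x) xor subsetColouring b S x ≡ matrixImage (twisted B) (interlaced B) S (loop x)
  subsetColouring-m-< b S (i , s) i<q = begin
    (b xor P (endsBefore (q , s′))) xor (b xor P (endsBefore (i , s)))
      ≡⟨ cancel b _ _ ⟩
    P (endsBefore (q , s′)) xor P (endsBefore (i , s))
      ≡⟨ parityBefore-crossing (endIn S) i<q s s′ ⟩
    ∑[ j < n + n ] (strictlyBetween (toℕ i) (toℕ q) (toℕ j) ∧ endIn S j)
      xor ((not s ∧ lookup S e) xor (s′ ∧ endIn S q))
      ≡⟨ cong₂ (λ a b → a xor ((not s ∧ lookup S e) xor (s′ ∧ b)))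
               (between-interlaced S (i , s)) (endIn-pos S e (not β)) ⟩
    ∑[ f < n ] (lookup S f ∧ interlaced B e f) xor ((not s ∧ lookup S e) xor (s′ ∧ lookup S e))
      ≡⟨ cong (∑[ f < n ] (lookup S f ∧ interlaced B e f) xor_) (twist-parity (twisted B e) s (lookup S e)) ⟩
    ∑[ f < n ] (lookup S f ∧ interlaced B e f) xor (twisted B e ∧ lookup S e)
      ≡⟨ xor-comm (∑[ f < n ] (lookup S f ∧ interlaced B e f)) (twisted B e ∧ lookup S e) ⟩
    matrixImage (twisted B) (interlaced B) S e ∎
    where
    open ≡-Reasoning
    P = parityBefore (endIn S)
    e = proj₁ (lab B i)
    β = proj₂ (lab B i)
    q = pos B (e , not β)
    s′ = if twisted B e then s else not s
    cancel : ∀ b x y → (b xor x) xor (b xor y) ≡ x xor y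
    cancel = solve-∀ 𝔽₂

  subsetColouring-m : ∀ b S x → subsetColouring b S (m x) xor subsetColouring b S x
                                 ≡ matrixImage (twisted B) (interlaced B) S (loop x)
  subsetColouring-m b S x with <-cmp (toℕ (proj₁ x)) (toℕ (proj₁ (m x)))
  ... | tri< forward _ _ = subsetColouring-m-< b S x forward
  ... | tri≈ _ same _    = contradiction (toℕ-injective (sym same)) (m-moves x)
  ... | tri> _ _ backward = begin
    subsetColouring b S (m x) xor subsetColouring b S x
      ≡⟨ xor-comm (subsetColouring b S (m x)) (subsetColouring b S x) ⟩
    subsetColouring b S x xor subsetColouring b S (m x)
      ≡⟨ cong (λ y → subsetColouring b S y xor subsetColouring b S (m x)) (edgeMatch-involutive x) ⟨
    subsetColouring b S (m (m x)) xor subsetColouring b S (m x)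
      ≡⟨ subsetColouring-m-< b S (m x) (subst (λ y → toℕ (proj₁ (m x)) < toℕ (proj₁ y))
                                              (sym (edgeMatch-involutive x)) backward) ⟩
    matrixImage (twisted B) (interlaced B) S (loop (m x))
      ≡⟨ cong (matrixImage (twisted B) (interlaced B) S) (loop-m x) ⟩
    matrixImage (twisted B) (interlaced B) S (loop x) ∎
    where open ≡-Reasoning

-- Without loops there are no side points, so `faces` is 0 rather than 1; the count below needs a loop.
module FaceCount {n : ℕ} (B : Bouquet (suc n)) where

  open Boundary B
  open LoopSetColouring B

  jump : (Point (suc n) → Bool) → Fin (suc n + suc n) → Bool
  jump H i = H (i , true) xor H (i , false)

  jumpSet : (Point (suc n) → Bool) → Subset (suc n)
  jumpSet H = tabulate (λ e → jump H (pos B (e , false)))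

  jump-subsetColouring : ∀ b S i → jump (subsetColouring b S) i ≡ endIn S i
  jump-subsetColouring b S i =
    trans (cong (λ a → (b xor a) xor (b xor P (toℕ i))) (parityBefore-suc (endIn S) i))
          (cancel b (P (toℕ i)) (endIn S i))
    where
    P = parityBefore (endIn S)
    cancel : ∀ b x y → (b xor (x xor y)) xor (b xor x) ≡ y
    cancel = solve-∀ 𝔽₂

  module _ (H : Point (suc n) → Bool) (H-c : ∀ x → H (c x) ≡ H x) (H-m : ∀ x → H (m x) ≡ H x) where

    private
      b = H (zero , false)
      d = endIn (jumpSet H)
      P = parityBefore d

    jump-m : ∀ i → jump H (proj₁ (m (i , false))) ≡ jump H i
    jump-m i = trans (swap-sides (twisted B (loop (i , false)))) (cong₂ _xor_ (H-m (i , true)) (H-m (i , false)))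
      where
      q = proj₁ (m (i , false))
      swap-sides : ∀ t → jump H q ≡ H (q , (if t then true else false)) xor H (q , (if t then false else true))
      swap-sides true  = refl
      swap-sides false = xor-comm (H (q , true)) (H (q , false))

    jump≡endIn : ∀ i → jump H i ≡ d i
    jump≡endIn i =
      sym (trans (lookup∘tabulate (λ e → jump H (pos B (e , false))) (loop (i , false))) (at-end (proj₂ (lab B i)) refl))
      where
      at-end : ∀ β → proj₂ (lab B i) ≡ β → jump H (pos B (loop (i , false) , false)) ≡ jump H i
      at-end false β≡ = cong (jump H) (trans (cong (λ β → pos B (loop (i , false) , β)) (sym β≡)) (pos∘lab B i))
      at-end true  β≡ = trans (cong (λ β → jump H (pos B (loop (i , false) , not β))) (sym β≡)) (jump-m i)

    recover-right : ∀ i → H (i , false) ≡ b xor P (toℕ i) → H (i , true) ≡ b xor P (suc (toℕ i))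
    recover-right i left = begin
      H (i , true)                ≡⟨ split (H (i , true)) (H (i , false)) ⟩
      H (i , false) xor jump H i  ≡⟨ cong₂ _xor_ left (jump≡endIn i) ⟩
      (b xor P (toℕ i)) xor d i   ≡⟨ xor-assoc b (P (toℕ i)) (d i) ⟩
      b xor (P (toℕ i) xor d i)   ≡⟨ cong (b xor_) (parityBefore-suc d i) ⟨
      b xor P (suc (toℕ i))       ∎
      where
      open ≡-Reasoning
      split : ∀ x y → x ≡ y xor (x xor y)
      split = solve-∀ 𝔽₂

    recover-left : ∀ k i → toℕ i ≡ k → H (i , false) ≡ b xor P (toℕ i)
    recover-left zero    zero    _  = sym (trans (cong (b xor_) (parityBefore-zero d)) (xor-identityʳ b))
    recover-left (suc k) (suc j) eq = begin
      H (suc j , false)                ≡⟨ cong (λ i → H (i , false)) (sucMod-predMod (suc j)) ⟨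
      H (c (inject₁ j , true))         ≡⟨ H-c (inject₁ j , true) ⟩
      H (inject₁ j , true)
        ≡⟨ recover-right (inject₁ j) (recover-left k (inject₁ j) (trans (toℕ-inject₁ j) (suc-injective eq))) ⟩
      b xor P (suc (toℕ (inject₁ j)))  ≡⟨ cong (λ t → b xor P (suc t)) (toℕ-inject₁ j) ⟩
      b xor P (suc (toℕ j))            ∎
      where open ≡-Reasoning

    recover : ∀ x → H x ≡ subsetColouring b (jumpSet H) x
    recover (i , false) = recover-left (toℕ i) i refl
    recover (i , true)  = recover-right i (recover-left (toℕ i) i refl)

  invariant↔kernel : Correspondence Invariant (λ V → Kernel (twisted B) (interlaced B) (tail V))
  invariant↔kernel = record
    { to             = λ V → colour V (zero , false) ∷ jumpSet (colour V)
    ; from           = λ V → colouring (subsetColouring (head V) (tail V))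
    ; to-preserves   = λ {V} → to-preserves {V}
    ; from-preserves = λ {V} → from-preserves {V}
    ; from∘to        = λ {V} inv →
        trans (colouring-cong (λ x → sym (recover (colour V) (proj₁ ∘ inv) (proj₂ ∘ inv) x))) (colouring-colour V)
    ; to∘from        = λ {V} → to∘from {V}
    }
    where
    to-preserves : ∀ {V} → Invariant V → Kernel (twisted B) (interlaced B) (jumpSet (colour V))
    to-preserves {V} inv e = begin
      matrixImage (twisted B) (interlaced B) S e
        ≡⟨ cong (matrixImage (twisted B) (interlaced B) S ∘ proj₁) (lab∘pos B (e , false)) ⟨
      matrixImage (twisted B) (interlaced B) S (loop x)  ≡⟨ subsetColouring-m b S x ⟨
      subsetColouring b S (m x) xor subsetColouring b S x ≡⟨ cong₂ _xor_ (recover′ (m x)) (recover′ x) ⟨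
      H (m x) xor H x                                    ≡⟨ cong (_xor H x) (proj₂ (inv x)) ⟩
      H x xor H x                                        ≡⟨ xor-same (H x) ⟩
      false                                              ∎
      where
      open ≡-Reasoning
      H = colour V
      b = H (zero , false)
      S = jumpSet H
      x = (pos B (e , false) , false)
      recover′ = recover H (proj₁ ∘ inv) (proj₂ ∘ inv)
    from-preserves : ∀ {V} → Kernel (twisted B) (interlaced B) (tail V) →
                     Invariant (colouring (subsetColouring (head V) (tail V)))
    from-preserves {V} ker x =
      trans (colour-colouring h (c x)) (trans (subsetColouring-c (head V) (tail V) x) (sym (colour-colouring h x))) ,
      trans (colour-colouring h (m x)) (trans (xor≡false⇒≡ (trans (subsetColouring-m (head V) (tail V) x) (ker (loop x))))
                                              (sym (colour-colouring h x)))
      where h = subsetColouring (head V) (tail V)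
    to∘from : ∀ {V} → Kernel (twisted B) (interlaced B) (tail V) →
              colour (colouring (subsetColouring (head V) (tail V))) (zero , false)
                ∷ jumpSet (colour (colouring (subsetColouring (head V) (tail V)))) ≡ V
    to∘from {b ∷ S} _ = cong₂ _∷_
      (trans (colour-colouring h (zero , false)) (trans (cong (b xor_) (parityBefore-zero (endIn S))) (xor-identityʳ b)))
      (trans (tabulate-cong (λ e → begin
          jump (colour (colouring h)) (pos B (e , false))
            ≡⟨ cong₂ _xor_ (colour-colouring h (pos B (e , false) , true))
                           (colour-colouring h (pos B (e , false) , false)) ⟩
          jump h (pos B (e , false))   ≡⟨ jump-subsetColouring b S (pos B (e , false)) ⟩
          endIn S (pos B (e , false))  ≡⟨ endIn-pos S e false ⟩
          lookup S e                   ∎))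
        (tabulate∘lookup S))
      where
      open ≡-Reasoning
      h = subsetColouring b S

  2^faces≡2*kernel : 2 ^ faces B ≡ 2 * count (kernel? (twisted B) (interlaced B)) (allSubsets (suc n))
  2^faces≡2*kernel = begin
    2 ^ faces B                                               ≡⟨ 2^faces≡count-invariant ⟩
    count invariant? (allSubsets _)                           ≡⟨ count-correspondence invariant? (kernel?′ ∘ tail)
                                                                   (subsets-enumeration _) (subsets-enumeration _) invariant↔kernel ⟩
    count (kernel?′ ∘ tail) (allSubsets (suc (suc n)))        ≡⟨ count-tail kernel?′ ⟩
    2 * count kernel?′ (allSubsets (suc n))                   ∎
    where
    open ≡-Reasoning
    kernel?′ = kernel? (twisted B) (interlaced B)

relabel : ∀ {k} → Permutation′ k → Subset k → Subset k
relabel φ S = tabulate (λ i → lookup S (φ ⟨$⟩ˡ i))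

lookup-relabel : ∀ {k} (φ : Permutation′ k) S e → lookup (relabel φ S) (φ ⟨$⟩ʳ e) ≡ lookup S e
lookup-relabel φ S e = trans (lookup∘tabulate _ (φ ⟨$⟩ʳ e)) (cong (lookup S) (inverseˡ φ))

relabel-inverse : ∀ {k} (φ : Permutation′ k) S → relabel (flip φ) (relabel φ S) ≡ S
relabel-inverse φ S = trans (tabulate-cong (lookup-relabel φ S)) (tabulate∘lookup S)

module _ {k} (φ : Permutation′ k) {t₁ t₂ : Fin k → Bool} {I₁ I₂ : Fin k → Fin k → Bool}
         (t≡ : ∀ e → t₁ e ≡ t₂ (φ ⟨$⟩ʳ e)) (I≡ : ∀ e f → I₁ e f ≡ I₂ (φ ⟨$⟩ʳ e) (φ ⟨$⟩ʳ f)) where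

  matrixImage-relabel : ∀ S e → matrixImage t₂ I₂ (relabel φ S) (φ ⟨$⟩ʳ e) ≡ matrixImage t₁ I₁ S e
  matrixImage-relabel S e = cong₂ _xor_
    (cong₂ _∧_ (sym (t≡ e)) (lookup-relabel φ S e))
    (trans (∑-permute (λ f → lookup (relabel φ S) f ∧ I₂ (φ ⟨$⟩ʳ e) f) φ)
           (sum-cong-≗ (λ f → cong₂ _∧_ (lookup-relabel φ S f) (sym (I≡ e f)))))

  count-kernel-relabel : count (kernel? t₁ I₁) (allSubsets k) ≡ count (kernel? t₂ I₂) (allSubsets k)
  count-kernel-relabel =
    count-correspondence (kernel? t₁ I₁) (kernel? t₂ I₂) (subsets-enumeration k) (subsets-enumeration k) (record
      { to             = relabel φ
      ; from           = relabel (flip φ)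
      ; to-preserves   = λ {S} ker e → trans (cong (matrixImage t₂ I₂ (relabel φ S)) (sym (inverseʳ φ)))
                                             (trans (matrixImage-relabel S (φ ⟨$⟩ˡ e)) (ker (φ ⟨$⟩ˡ e)))
      ; from-preserves = λ {S} ker e → trans (sym (matrixImage-relabel (relabel (flip φ) S) e))
                                             (trans (cong (λ S′ → matrixImage t₂ I₂ S′ (φ ⟨$⟩ʳ e)) (relabel-inverse (flip φ) S))
                                                    (ker (φ ⟨$⟩ʳ e)))
      ; from∘to        = λ {S} _ → relabel-inverse φ S
      ; to∘from        = λ {S} _ → relabel-inverse (flip φ) S
      })

2^-injective : ∀ {a b} → 2 ^ a ≡ 2 ^ b → a ≡ b
2^-injective {a} {b} eq with <-cmp a b
... | tri< a<b _ _ = contradiction eq (<⇒≢ (^-monoʳ-< 2 (s≤s (s≤s z≤n)) a<b))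
... | tri≈ _ a≡b _ = a≡b
... | tri> _ _ b<a = contradiction (sym eq) (<⇒≢ (^-monoʳ-< 2 (s≤s (s≤s z≤n)) b<a))

faces-relabel : ∀ {n} (B₁ B₂ : Bouquet (suc n)) (φ : Permutation′ (suc n)) →
                (∀ e → twisted B₁ e ≡ twisted B₂ (φ ⟨$⟩ʳ e)) →
                (∀ e f → interlaced B₁ e f ≡ interlaced B₂ (φ ⟨$⟩ʳ e) (φ ⟨$⟩ʳ f)) →
                faces B₁ ≡ faces B₂
faces-relabel {n} B₁ B₂ φ t≡ I≡ = 2^-injective (begin
  2 ^ faces B₁                                                           ≡⟨ FaceCount.2^faces≡2*kernel B₁ ⟩
  2 * count (kernel? (twisted B₁) (interlaced B₁)) (allSubsets (suc n))
    ≡⟨ cong (2 *_) (count-kernel-relabel φ {t₂ = twisted B₂} {I₂ = interlaced B₂} t≡ I≡) ⟩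
  2 * count (kernel? (twisted B₂) (interlaced B₂)) (allSubsets (suc n))  ≡⟨ FaceCount.2^faces≡2*kernel B₂ ⟨
  2 ^ faces B₂                                                           ∎)
  where open ≡-Reasoning

samePetrialPoly-by-bijection : ∀ {n} {B₁ B₂ : Bouquet n} (τ σ : Subset n → Subset n) →
  (∀ A → σ (τ A) ≡ A) → (∀ A → τ (σ A) ≡ A) →
  (∀ A → faces (partialPetrial B₁ A) ≡ faces (partialPetrial B₂ (τ A))) →
  SamePetrialPoly B₁ B₂
samePetrialPoly-by-bijection {n} {B₁} {B₂} τ σ σ∘τ τ∘σ faces≡ k = begin
  petrialCoeff B₁ k                                  ≡⟨ countTrue-genus B₁ ⟩
  count (genus≟ B₁) (allSubsets n)
    ≡⟨ count-correspondence (genus≟ B₁) (genus≟ B₂) (subsets-enumeration n) (subsets-enumeration n) (record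
         { to             = τ
         ; from           = σ
         ; to-preserves   = λ {A} g≡k → trans (sym (genus≡ A)) g≡k
         ; from-preserves = λ {A} g≡k → trans (genus≡ (σ A)) (trans (cong (eulerGenus ∘ partialPetrial B₂) (τ∘σ A)) g≡k)
         ; from∘to        = λ {A} _ → σ∘τ A
         ; to∘from        = λ {A} _ → τ∘σ A
         }) ⟩
  count (genus≟ B₂) (allSubsets n)                   ≡⟨ countTrue-genus B₂ ⟨
  petrialCoeff B₂ k                                  ∎
  where
  open ≡-Reasoning
  genus≡ : ∀ A → eulerGenus (partialPetrial B₁ A) ≡ eulerGenus (partialPetrial B₂ (τ A))
  genus≡ A = cong (λ f → ((ℤ.+ 2) ℤ.* (ℤ.+ 1) ℤ.- (ℤ.+ 1)) ℤ.+ (ℤ.+ n) ℤ.- (ℤ.+ f)) (faces≡ A)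
  genus≟ : (B′ : Bouquet n) → Decidable (λ A → eulerGenus (partialPetrial B′ A) ≡ k)
  genus≟ B′ A = eulerGenus (partialPetrial B′ A) ℤ.≟ k
  countTrue-genus : ∀ B′ → petrialCoeff B′ k ≡ count (genus≟ B′) (allSubsets n)
  countTrue-genus B′ = trans (cong countTrue (map-cong (isYes≗does ∘ genus≟ B′) (allSubsets n)))
                             (countTrue-map (genus≟ B′) (allSubsets n))

retwist : ∀ {k} → Permutation′ k → (t₁ t₂ : Fin k → Bool) → Subset k → Subset k
retwist φ t₁ t₂ A = tabulate (λ i → t₂ i xor (t₁ (φ ⟨$⟩ˡ i) xor lookup A (φ ⟨$⟩ˡ i)))

lookup-retwist : ∀ {k} (φ : Permutation′ k) t₁ t₂ A e →
                 t₂ (φ ⟨$⟩ʳ e) xor lookup (retwist φ t₁ t₂ A) (φ ⟨$⟩ʳ e) ≡ t₁ e xor lookup A e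
lookup-retwist φ t₁ t₂ A e = trans
  (cong (t₂ (φ ⟨$⟩ʳ e) xor_) (trans (lookup∘tabulate _ (φ ⟨$⟩ʳ e))
    (cong (λ e′ → t₂ (φ ⟨$⟩ʳ e) xor (t₁ e′ xor lookup A e′)) (inverseˡ φ))))
  (xor-cancelˡ (t₂ (φ ⟨$⟩ʳ e)) (t₁ e xor lookup A e))

retwist-inverse : ∀ {k} (φ : Permutation′ k) t₁ t₂ A → retwist (flip φ) t₂ t₁ (retwist φ t₁ t₂ A) ≡ A
retwist-inverse φ t₁ t₂ A = trans
  (tabulate-cong (λ e → trans (cong (t₁ e xor_) (lookup-retwist φ t₁ t₂ A e)) (xor-cancelˡ (t₁ e) (lookup A e))))
  (tabulate∘lookup A)

theorem2p4 : ∀ (n : ℕ) (B₁ B₂ : Bouquet n) (φ : Permutation′ n)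
    → (∀ e f → interlaced B₁ e f ≡ interlaced B₂ (φ ⟨$⟩ʳ e) (φ ⟨$⟩ʳ f))
    → SamePetrialPoly B₁ B₂
theorem2p4 zero    B₁ B₂ φ I≡ k = refl
theorem2p4 (suc n) B₁ B₂ φ I≡ =
  samePetrialPoly-by-bijection {B₁ = B₁} {B₂} τ (retwist (flip φ) t₂ t₁)
    (retwist-inverse φ t₁ t₂) (retwist-inverse (flip φ) t₂ t₁)
    (λ A → faces-relabel (partialPetrial B₁ A) (partialPetrial B₂ (τ A)) φ (λ e → sym (lookup-retwist φ t₁ t₂ A e)) I≡)
  where
  t₁ = twisted B₁
  t₂ = twisted B₂
  τ = retwist φ t₁ t₂
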